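{- Let $V$ be a 2-dimensional vector space over a field $k$. Let $v_1,v_2,v_3\in V$ be nonzero and pairwise noncolinear, and let $\lambda_1,\lambda_2,\lambda_3\in V^*$ be nonzero with $\lambda_i(v_i)=0$ for each $i$. Let $h$ be the trilinear form on $\mathrm{L}(V)$ given by $h(a_1,a_2,a_3)=\mathrm{tr}(a_1)\mathrm{tr}(a_2)\mathrm{tr}(a_3)-\mathrm{tr}(a_1a_2a_3)$. Then $\lambda_1(v_2)\lambda_2(v_3)\lambda_3(v_1)\neq0$ and $$h=\frac{ -1}{\lambda_1(v_2)\lambda_2(v_3)\lambda_3(v_1)}\sum_{\sigma\in S_3}\varepsilon(\sigma)\bigotimes_{i=1,2,3}\iota^*\big(v_{\sigma(i)}\otimes\lambda_{\sigma(123)(i)}\big),$$ that is, for all $a_1,a_2,a_3\in\mathrm{L}(V)$, $$h(a_1,a_2,a_3)=\frac{ -1}{\lambda_1(v_2)\lambda_2(v_3)\lambda_3(v_1)}\sum_{\sigma\in S_3}\varepsilon(\sigma)\prod_{i=1}^3\lambda_{\sigma(123)(i)}\big(a_i(v_{\sigma(i)})\big).$$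
   Context: $\mathrm{L}(V)$ is the space of linear maps $V\to V$. For $v\in V$, $\lambda\in V^*$, $\iota^*(v\otimes\lambda)$ is the linear form $a\mapsto\lambda(a(v))$ on $\mathrm{L}(V)$, and a tensor product $\mu_1\otimes\mu_2\otimes\mu_3$ of linear forms is the trilinear form $(a_1,a_2,a_3)\mapsto\mu_1(a_1)\mu_2(a_2)\mu_3(a_3)$. $\varepsilon(\sigma)$ is the signature of $\sigma$; $(123)$ is the cycle $1\mapsto2\mapsto3\mapsto1$, and $\sigma(123)$ denotes the composite permutation $\sigma\circ(123)$. (Given the hypotheses $v_i,\lambda_i$ nonzero with $\lambda_i(v_i)=0$, the condition that the $v_i$ are pairwise noncolinear is equivalent to the $\lambda_i$ being pairwise noncolinear, and to the forms $a\mapsto\lambda_i(a(v_i))$ forming a basis of the forms on $\mathrm{L}(V)$ vanishing on the identity.) -}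

module Defs where

open import Level using (Level; _⊔_) renaming (suc to lsuc)
open import Algebra.Bundles using (CommutativeRing)
open import Relation.Nullary using (¬_)
open import Data.Fin using (Fin; zero; suc; toℕ)
open import Data.Nat as ℕ using (ℕ)
open import Data.Bool using (Bool; true; false; if_then_else_)
open import Data.Product using (Σ; ∃; _×_; _,_)
open import Data.Sum using (_⊎_)
open import Data.List using (List; []; _∷_; foldr; map)

record Field (c ℓ : Level) : Set (lsuc (c ⊔ ℓ)) where
  field
    commutativeRing : CommutativeRing c ℓ
  open CommutativeRing commutativeRing public
  field
    0≉1        : ¬ (0# ≈ 1#)
    inv        : (x : Carrier) → ¬ (x ≈ 0#) → Carrier
    inv-cancel : (x : Carrier) (p : ¬ (x ≈ 0#)) → x * inv x p ≈ 1#

-- Permutations of {1,2,3} (indices 0,1,2), as functions Fin 3 → Fin 3.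
Perm3 : Set
Perm3 = Fin 3 → Fin 3

f0 f1 f2 : Fin 3
f0 = zero
f1 = suc zero
f2 = suc (suc zero)

mkPerm : Fin 3 → Fin 3 → Fin 3 → Perm3
mkPerm a b c zero = a
mkPerm a b c (suc zero) = b
mkPerm a b c (suc (suc zero)) = c

S₃ : List Perm3
S₃ = mkPerm f0 f1 f2 ∷ mkPerm f0 f2 f1 ∷ mkPerm f1 f0 f2
   ∷ mkPerm f1 f2 f0 ∷ mkPerm f2 f0 f1 ∷ mkPerm f2 f1 f0 ∷ []

cyc : Perm3
cyc = mkPerm f1 f2 f0

_∘p_ : Perm3 → Perm3 → Perm3
(σ ∘p τ) i = σ (τ i)

inv? : Fin 3 → Fin 3 → ℕ
inv? x y with toℕ y ℕ.<ᵇ toℕ x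
... | true  = 1
... | false = 0

inversions : Perm3 → ℕ
inversions σ = inv? (σ f0) (σ f1) ℕ.+ inv? (σ f0) (σ f2) ℕ.+ inv? (σ f1) (σ f2)

isEven : ℕ → Bool
isEven ℕ.zero = true
isEven (ℕ.suc ℕ.zero) = false
isEven (ℕ.suc (ℕ.suc n)) = isEven n

module FieldDefs {c ℓ : Level} (F : Field c ℓ) where
  open Field F using (Carrier; _≈_; _+_; _*_; _-_; -_; 0#)

  -- V = k², V* = k² (dual coordinates), L(V) = 2×2 matrices (coordinates
  -- w.r.t. a basis of the 2-dimensional space V and its dual basis).
  Vect : Set c
  Vect = Fin 2 → Carrier

  Covect : Set c
  Covect = Fin 2 → Carrier

  Mat : Set c
  Mat = Fin 2 → Fin 2 → Carrier

  Σ₂ : (Fin 2 → Carrier) → Carrier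
  Σ₂ f = f zero + f (suc zero)

  ev : Covect → Vect → Carrier
  ev l v = Σ₂ (λ j → l j * v j)

  app : Mat → Vect → Vect
  app a v i = Σ₂ (λ j → a i j * v j)

  _⊙_ : Mat → Mat → Mat
  (a ⊙ b) i j = Σ₂ (λ m → a i m * b m j)

  tr : Mat → Carrier
  tr a = Σ₂ (λ i → a i i)

  NonzeroVec : (Fin 2 → Carrier) → Set ℓ
  NonzeroVec v = ¬ (∀ i → v i ≈ 0#)

  Colinear : Vect → Vect → Set (c ⊔ ℓ)
  Colinear v w = Σ Carrier λ α → Σ Carrier λ β →
    (¬ (α ≈ 0#) ⊎ ¬ (β ≈ 0#)) × (∀ i → α * v i + β * w i ≈ 0#)

  h : Mat → Mat → Mat → Carrier
  h a₁ a₂ a₃ = tr a₁ * tr a₂ * tr a₃ - tr (a₁ ⊙ (a₂ ⊙ a₃))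

  signed : Perm3 → Carrier → Carrier
  signed σ x = if isEven (inversions σ) then x else - x

  prod₃ : (Fin 3 → Carrier) → Carrier
  prod₃ f = f f0 * (f f1 * f f2)

  sumList : List Carrier → Carrier
  sumList = foldr _+_ 0#

  altSum : (Fin 3 → Vect) → (Fin 3 → Covect) → (Fin 3 → Mat) → Carrier
  altSum v l a = sumList (map (λ σ → signed σ
      (prod₃ (λ i → ev (l ((σ ∘p cyc) i)) (app (a i) (v (σ i)))))) S₃)

{-# OPTIONS --safe #-}
module Submission where

-- In the plane, a covector λ with λ(v) = 0 is a multiple of det(v, ·), the
-- factor being read off at any w with det(v, w) ≠ 0 (Cramer's rule).  For
-- non-colinear vᵢ, vᵢ₊₁ this gives λᵢ = cᵢ det(vᵢ, ·) and also forces
-- λᵢ(vᵢ₊₁) ≠ 0.  After this substitution both sides of the identity are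
-- polynomials with integer coefficients in the cᵢ and the coordinates of the
-- vᵢ and aᵢ, and they agree identically, as ring normalisation confirms.

open import Defs
open import Level using (Level)
open import Algebra.Bundles using (CommutativeRing)
open import Algebra.Solver.Ring.AlmostCommutativeRing
  using (fromCommutativeRing; _-Raw-AlmostCommutative⟶_)
import Algebra.Solver.Ring
open import Data.Bool using (true; false; if_then_else_)
open import Data.Fin using (Fin; zero; suc)
open import Data.Integer as ℤ using (ℤ; +_; -[1+_]; _⊖_)
import Data.Integer.Properties as ℤ
open import Data.List using ([]; _∷_; foldr; map)
open import Data.Maybe using (Maybe; just; nothing)
open import Data.Nat as ℕ using (ℕ; zero; suc)
import Data.Nat.Properties as ℕ
open import Data.Product using (Σ; _,_)
open import Data.Sum using (inj₁)
open import Relation.Nullary using (¬_; yes; no)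
open import Relation.Binary.PropositionalEquality as ≡ using (_≢_; cong)

-- Normalising with integer coefficients, whose vanishing is decidable, is what
-- lets the solver see cancellations such as x - x ≈ 0 in an arbitrary
-- commutative ring.
module IntegerCoefficients {c ℓ : Level} (R : CommutativeRing c ℓ) where
  open CommutativeRing R
  open import Algebra.Properties.Semiring.Mult semiring using (_×_; ×-homo-+; ×1-homo-*)
  open import Algebra.Properties.Ring ring using (-0#≈0#; -‿distribˡ-*; -‿distribʳ-*; -‿involutive)
  open import Algebra.Properties.AbelianGroup +-abelianGroup using (⁻¹-∙-comm)
  open import Algebra.Properties.CommutativeSemigroup +-commutativeSemigroup using (interchange)
  open import Relation.Binary.Reasoning.Setoid setoid

  ⟦_⟧ℤ : ℤ → Carrier
  ⟦ + n ⟧ℤ      = n × 1#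
  ⟦ -[1+ n ] ⟧ℤ = - (suc n × 1#)

  x+y-[x+z]≈y-z : ∀ x y z → (x + y) - (x + z) ≈ y - z
  x+y-[x+z]≈y-z x y z = begin
    (x + y) - (x + z)     ≈⟨ +-congˡ (⁻¹-∙-comm x z) ⟨
    (x + y) + (- x - z)   ≈⟨ interchange x y (- x) (- z) ⟩
    (x - x) + (y - z)     ≈⟨ +-congʳ (-‿inverseʳ x) ⟩
    0# + (y - z)          ≈⟨ +-identityˡ _ ⟩
    y - z                 ∎

  ⊖-homo : ∀ m n → ⟦ m ⊖ n ⟧ℤ ≈ m × 1# - n × 1#
  ⊖-homo zero    zero    = sym (-‿inverseʳ 0#)
  ⊖-homo (suc m) zero    = sym (trans (+-congˡ -0#≈0#) (+-identityʳ _))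
  ⊖-homo zero    (suc n) = sym (+-identityˡ _)
  ⊖-homo (suc m) (suc n) = begin
    ⟦ suc m ⊖ suc n ⟧ℤ        ≡⟨ cong ⟦_⟧ℤ (ℤ.[1+m]⊖[1+n]≡m⊖n m n) ⟩
    ⟦ m ⊖ n ⟧ℤ                ≈⟨ ⊖-homo m n ⟩
    m × 1# - n × 1#           ≈⟨ x+y-[x+z]≈y-z 1# (m × 1#) (n × 1#) ⟨
    suc m × 1# - suc n × 1#   ∎

  +-homo : ∀ i j → ⟦ i ℤ.+ j ⟧ℤ ≈ ⟦ i ⟧ℤ + ⟦ j ⟧ℤ
  +-homo (+ m)    (+ n)    = ×-homo-+ 1# m n
  +-homo (+ m)    -[1+ n ] = ⊖-homo m (suc n)
  +-homo -[1+ m ] (+ n)    = trans (⊖-homo n (suc m)) (+-comm _ _)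
  +-homo -[1+ m ] -[1+ n ] = begin
    - (suc (suc (m ℕ.+ n)) × 1#)      ≡⟨ cong (λ k → - (suc k × 1#)) (ℕ.+-suc m n) ⟨
    - ((suc m ℕ.+ suc n) × 1#)        ≈⟨ -‿cong (×-homo-+ 1# (suc m) (suc n)) ⟩
    - (suc m × 1# + suc n × 1#)       ≈⟨ ⁻¹-∙-comm _ _ ⟨
    - (suc m × 1#) + - (suc n × 1#)   ∎

  -‿homo : ∀ i → ⟦ ℤ.- i ⟧ℤ ≈ - ⟦ i ⟧ℤ
  -‿homo (+ zero)  = sym -0#≈0#
  -‿homo (+ suc n) = refl
  -‿homo -[1+ n ]  = sym (-‿involutive _)

  *-homo : ∀ i j → ⟦ i ℤ.* j ⟧ℤ ≈ ⟦ i ⟧ℤ * ⟦ j ⟧ℤ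
  *-homo (+ m) (+ n) = begin
    ⟦ + m ℤ.* + n ⟧ℤ       ≡⟨ cong ⟦_⟧ℤ (ℤ.+◃n≡+n (m ℕ.* n)) ⟩
    (m ℕ.* n) × 1#         ≈⟨ ×1-homo-* m n ⟩
    m × 1# * n × 1#        ∎
  *-homo (+ m) -[1+ n ] = begin
    ⟦ + m ℤ.* -[1+ n ] ⟧ℤ      ≡⟨ cong ⟦_⟧ℤ (ℤ.-◃n≡-n (m ℕ.* suc n)) ⟩
    ⟦ ℤ.- + (m ℕ.* suc n) ⟧ℤ   ≈⟨ -‿homo (+ (m ℕ.* suc n)) ⟩
    - ((m ℕ.* suc n) × 1#)     ≈⟨ -‿cong (×1-homo-* m (suc n)) ⟩
    - (m × 1# * suc n × 1#)    ≈⟨ -‿distribʳ-* _ _ ⟩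
    m × 1# * - (suc n × 1#)    ∎
  *-homo -[1+ m ] (+ n) = begin
    ⟦ -[1+ m ] ℤ.* + n ⟧ℤ      ≡⟨ cong ⟦_⟧ℤ (ℤ.-◃n≡-n (suc m ℕ.* n)) ⟩
    ⟦ ℤ.- + (suc m ℕ.* n) ⟧ℤ   ≈⟨ -‿homo (+ (suc m ℕ.* n)) ⟩
    - ((suc m ℕ.* n) × 1#)     ≈⟨ -‿cong (×1-homo-* (suc m) n) ⟩
    - (suc m × 1# * n × 1#)    ≈⟨ -‿distribˡ-* _ _ ⟩
    - (suc m × 1#) * n × 1#    ∎
  *-homo -[1+ m ] -[1+ n ] = begin
    (suc m ℕ.* suc n) × 1#            ≈⟨ ×1-homo-* (suc m) (suc n) ⟩
    suc m × 1# * suc n × 1#           ≈⟨ -‿involutive _ ⟨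
    - - (suc m × 1# * suc n × 1#)     ≈⟨ -‿cong (-‿distribˡ-* _ _) ⟩
    - (- (suc m × 1#) * suc n × 1#)   ≈⟨ -‿distribʳ-* _ _ ⟩
    - (suc m × 1#) * - (suc n × 1#)   ∎

  ℤ⟶R : ℤ.+-*-rawRing -Raw-AlmostCommutative⟶ fromCommutativeRing R
  ℤ⟶R = record
    { ⟦_⟧    = ⟦_⟧ℤ
    ; +-homo = +-homo
    ; *-homo = *-homo
    ; -‿homo = -‿homo
    ; 0-homo = refl
    ; 1-homo = +-identityʳ 1#
    }

  ⟦⟧ℤ-≟ : ∀ i j → Maybe (⟦ i ⟧ℤ ≈ ⟦ j ⟧ℤ)
  ⟦⟧ℤ-≟ i j with i ℤ.≟ j
  ... | yes ≡.refl = just refl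
  ... | no _       = nothing

  open Algebra.Solver.Ring ℤ.+-*-rawRing (fromCommutativeRing R) ℤ⟶R ⟦⟧ℤ-≟ public
    using (solve; _:=_; Polynomial; con; _:+_; _:-_; _:*_; :-_)

cyc-fixpoint-free : ∀ j → j ≢ cyc j
cyc-fixpoint-free zero             ()
cyc-fixpoint-free (suc zero)       ()
cyc-fixpoint-free (suc (suc zero)) ()

module Plane {c ℓ : Level} (F : Field c ℓ) where
  open Field F hiding (zero)
  open FieldDefs F
  open IntegerCoefficients commutativeRing
  open import Algebra.Properties.Ring ring using (-0#≈0#; -‿distribˡ-*; -‿distribʳ-*)
  open import Relation.Binary.Reasoning.Setoid setoid

  x*y≈z⇒y≈x⁻¹*z : ∀ {x y z} (x≉0 : ¬ x ≈ 0#) → x * y ≈ z → y ≈ inv x x≉0 * z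
  x*y≈z⇒y≈x⁻¹*z {x} {y} {z} x≉0 xy≈z = begin
    y                       ≈⟨ *-identityˡ y ⟨
    1# * y                  ≈⟨ *-congʳ (trans (*-comm _ _) (inv-cancel x x≉0)) ⟨
    inv x x≉0 * x * y       ≈⟨ *-assoc _ x y ⟩
    inv x x≉0 * (x * y)     ≈⟨ *-congˡ xy≈z ⟩
    inv x x≉0 * z           ∎

  x*y≈0⇒y≈0 : ∀ {x y} → ¬ x ≈ 0# → x * y ≈ 0# → y ≈ 0#
  x*y≈0⇒y≈0 x≉0 xy≈0 = trans (x*y≈z⇒y≈x⁻¹*z x≉0 xy≈0) (zeroʳ _)

  x*-y≈-x*y : ∀ x y → x * - y ≈ - x * y
  x*-y≈-x*y x y = trans (sym (-‿distribʳ-* x y)) (-‿distribˡ-* x y)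

  *-nonzero : ∀ {x y} → ¬ x ≈ 0# → ¬ y ≈ 0# → ¬ x * y ≈ 0#
  *-nonzero x≉0 y≉0 xy≈0 = y≉0 (x*y≈0⇒y≈0 x≉0 xy≈0)

  det : Vect → Vect → Carrier
  det u w = u zero * w (suc zero) - u (suc zero) * w zero

  perp : Vect → Covect
  perp v zero       = - v (suc zero)
  perp v (suc zero) = v zero

  _∙_ : Carrier → Covect → Covect
  (x ∙ l) k = x * l k

  cramer : ∀ l v w k → det v w * l k ≈ ev l w * perp v k - ev l v * perp w k
  cramer l v w zero = solve 6 (λ l₀ l₁ v₀ v₁ w₀ w₁ →
    (v₀ :* w₁ :- v₁ :* w₀) :* l₀ := (l₀ :* w₀ :+ l₁ :* w₁) :* (:- v₁) :- (l₀ :* v₀ :+ l₁ :* v₁) :* (:- w₁))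
    refl (l zero) (l (suc zero)) (v zero) (v (suc zero)) (w zero) (w (suc zero))
  cramer l v w (suc zero) = solve 6 (λ l₀ l₁ v₀ v₁ w₀ w₁ →
    (v₀ :* w₁ :- v₁ :* w₀) :* l₁ := (l₀ :* w₀ :+ l₁ :* w₁) :* v₀ :- (l₀ :* v₀ :+ l₁ :* v₁) :* w₀)
    refl (l zero) (l (suc zero)) (v zero) (v (suc zero)) (w zero) (w (suc zero))

  annihilator-cramer : ∀ l v w → ev l v ≈ 0# → ∀ k → det v w * l k ≈ ev l w * perp v k
  annihilator-cramer l v w lv≈0 k = begin
    det v w * l k                              ≈⟨ cramer l v w k ⟩
    ev l w * perp v k - ev l v * perp w k      ≈⟨ +-congˡ (-‿cong (trans (*-congʳ lv≈0) (zeroˡ _))) ⟩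
    ev l w * perp v k - 0#                     ≈⟨ +-congˡ -0#≈0# ⟩
    ev l w * perp v k + 0#                     ≈⟨ +-identityʳ _ ⟩
    ev l w * perp v k                          ∎

  annihilator-∝-perp : ∀ l v w → ev l v ≈ 0# → (d≉0 : ¬ det v w ≈ 0#) →
                       ∀ k → l k ≈ (inv (det v w) d≉0 * ev l w) * perp v k
  annihilator-∝-perp l v w lv≈0 d≉0 k =
    trans (x*y≈z⇒y≈x⁻¹*z d≉0 (annihilator-cramer l v w lv≈0 k)) (sym (*-assoc _ _ _))

  annihilator-nonzero : ∀ l v w → NonzeroVec l → ev l v ≈ 0# → ¬ det v w ≈ 0# → ¬ ev l w ≈ 0#
  annihilator-nonzero l v w l≉0 lv≈0 d≉0 lw≈0 = l≉0 λ k →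
    x*y≈0⇒y≈0 d≉0 (trans (annihilator-cramer l v w lv≈0 k) (trans (*-congʳ lw≈0) (zeroˡ _)))

  ¬colinear⇒det≉0 : ∀ {u w} → NonzeroVec w → ¬ Colinear u w → ¬ det u w ≈ 0#
  ¬colinear⇒det≉0 {u} {w} w≉0 u∦w det≈0 =
    ¬¬w≈0 zero λ w₀≈0 → ¬¬w≈0 (suc zero) λ w₁≈0 →
      w≉0 λ { zero → w₀≈0 ; (suc zero) → w₁≈0 }
    where
    combination≈0 : ∀ k i → w k * u i + - u k * w i ≈ 0#
    combination≈0 zero zero =
      solve 2 (λ u₀ w₀ → w₀ :* u₀ :+ :- u₀ :* w₀ := con (+ 0)) refl (u zero) (w zero)
    combination≈0 (suc zero) (suc zero) =
      solve 2 (λ u₁ w₁ → w₁ :* u₁ :+ :- u₁ :* w₁ := con (+ 0)) refl (u (suc zero)) (w (suc zero))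
    combination≈0 zero (suc zero) = begin
      w zero * u (suc zero) + - u zero * w (suc zero)
        ≈⟨ solve 4 (λ u₀ u₁ w₀ w₁ → w₀ :* u₁ :+ :- u₀ :* w₁ := :- (u₀ :* w₁ :- u₁ :* w₀))
             refl (u zero) (u (suc zero)) (w zero) (w (suc zero)) ⟩
      - det u w   ≈⟨ -‿cong det≈0 ⟩
      - 0#        ≈⟨ -0#≈0# ⟩
      0#          ∎
    combination≈0 (suc zero) zero = begin
      w (suc zero) * u zero + - u (suc zero) * w zero
        ≈⟨ solve 4 (λ u₀ u₁ w₀ w₁ → w₁ :* u₀ :+ :- u₁ :* w₀ := u₀ :* w₁ :- u₁ :* w₀)
             refl (u zero) (u (suc zero)) (w zero) (w (suc zero)) ⟩
      det u w     ≈⟨ det≈0 ⟩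
      0#          ∎
    ¬¬w≈0 : ∀ k → ¬ ¬ w k ≈ 0#
    ¬¬w≈0 k wₖ≉0 = u∦w (w k , - u k , inj₁ wₖ≉0 , combination≈0 k)

  cycleProduct : (Fin 3 → Vect) → (Fin 3 → Covect) → Carrier
  cycleProduct v l = ev (l f0) (v f1) * ev (l f1) (v f2) * ev (l f2) (v f0)

  sumList-map-cong : ∀ {a} {A : Set a} {f g : A → Carrier} → (∀ x → f x ≈ g x) →
                     ∀ xs → sumList (map f xs) ≈ sumList (map g xs)
  sumList-map-cong f≈g []       = refl
  sumList-map-cong f≈g (x ∷ xs) = +-cong (f≈g x) (sumList-map-cong f≈g xs)

  signed-cong : ∀ σ {x y} → x ≈ y → signed σ x ≈ signed σ y
  signed-cong σ x≈y with isEven (inversions σ)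
  ... | true  = x≈y
  ... | false = -‿cong x≈y

  ev-congˡ : ∀ {l l′} → (∀ k → l k ≈ l′ k) → ∀ x → ev l x ≈ ev l′ x
  ev-congˡ l≈l′ x = +-cong (*-congʳ (l≈l′ zero)) (*-congʳ (l≈l′ (suc zero)))

  cycleProduct-cong : ∀ v {l l′} → (∀ j k → l j k ≈ l′ j k) → cycleProduct v l ≈ cycleProduct v l′
  cycleProduct-cong v l≈l′ =
    *-cong (*-cong (ev-congˡ (l≈l′ f0) (v f1)) (ev-congˡ (l≈l′ f1) (v f2))) (ev-congˡ (l≈l′ f2) (v f0))

  altSum-cong : ∀ v {l l′} → (∀ j k → l j k ≈ l′ j k) → ∀ a → altSum v l a ≈ altSum v l′ a
  altSum-cong v {l} {l′} l≈l′ a = sumList-map-cong (λ σ → signed-cong σ (factors-cong σ)) S₃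
    where
    factors-cong : ∀ σ → prod₃ (λ i → ev (l ((σ ∘p cyc) i)) (app (a i) (v (σ i))))
                       ≈ prod₃ (λ i → ev (l′ ((σ ∘p cyc) i)) (app (a i) (v (σ i))))
    factors-cong σ = *-cong (factor≈ f0) (*-cong (factor≈ f1) (factor≈ f2))
      where
      factor≈ : ∀ i → ev (l ((σ ∘p cyc) i)) (app (a i) (v (σ i)))
                    ≈ ev (l′ ((σ ∘p cyc) i)) (app (a i) (v (σ i)))
      factor≈ i = ev-congˡ (l≈l′ ((σ ∘p cyc) i)) (app (a i) (v (σ i)))

  fam₃ : ∀ {a} {A : Set a} → A → A → A → Fin 3 → A
  fam₃ x y z zero             = x
  fam₃ x y z (suc zero)       = y
  fam₃ x y z (suc (suc zero)) = z

  -- Copies of the coordinate formulas of FieldDefs over solver syntax: the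
  -- semantics of each copy unfolds definitionally to the original formula,
  -- which is what lets `solve` prove statements phrased with ev, h, altSum.
  module Symbolic {n : ℕ} where
    P : Set
    P = Polynomial n

    vec₂ : P → P → Fin 2 → P
    vec₂ p q zero       = p
    vec₂ p q (suc zero) = q

    mat₂ : P → P → P → P → Fin 2 → Fin 2 → P
    mat₂ p q r s zero       = vec₂ p q
    mat₂ p q r s (suc zero) = vec₂ r s

    Σ₂ₚ : (Fin 2 → P) → P
    Σ₂ₚ f = f zero :+ f (suc zero)

    evₚ : (Fin 2 → P) → (Fin 2 → P) → P
    evₚ l v = Σ₂ₚ (λ j → l j :* v j)

    appₚ : (Fin 2 → Fin 2 → P) → (Fin 2 → P) → Fin 2 → P
    appₚ a v i = Σ₂ₚ (λ j → a i j :* v j)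

    _⊙ₚ_ : (Fin 2 → Fin 2 → P) → (Fin 2 → Fin 2 → P) → Fin 2 → Fin 2 → P
    (a ⊙ₚ b) i j = Σ₂ₚ (λ m → a i m :* b m j)

    trₚ : (Fin 2 → Fin 2 → P) → P
    trₚ a = Σ₂ₚ (λ i → a i i)

    hₚ : (a₁ a₂ a₃ : Fin 2 → Fin 2 → P) → P
    hₚ a₁ a₂ a₃ = trₚ a₁ :* trₚ a₂ :* trₚ a₃ :- trₚ (a₁ ⊙ₚ (a₂ ⊙ₚ a₃))

    signedₚ : Perm3 → P → P
    signedₚ σ p = if isEven (inversions σ) then p else :- p

    prod₃ₚ : (Fin 3 → P) → P
    prod₃ₚ f = f f0 :* (f f1 :* f f2)

    altSumₚ : (Fin 3 → Fin 2 → P) → (Fin 3 → Fin 2 → P) → (Fin 3 → Fin 2 → Fin 2 → P) → P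
    altSumₚ v l a = foldr _:+_ (con (+ 0)) (map (λ σ → signedₚ σ
      (prod₃ₚ (λ i → evₚ (l ((σ ∘p cyc) i)) (appₚ (a i) (v (σ i)))))) S₃)

    perpₚ : (Fin 2 → P) → Fin 2 → P
    perpₚ v zero       = :- v (suc zero)
    perpₚ v (suc zero) = v zero

    cycleProductₚ : (Fin 3 → Fin 2 → P) → (Fin 3 → Fin 2 → P) → P
    cycleProductₚ v l = evₚ (l f0) (v f1) :* evₚ (l f1) (v f2) :* evₚ (l f2) (v f0)

  h-expansion-perp : ∀ (v : Fin 3 → Vect) (x : Fin 3 → Carrier) (a : Fin 3 → Mat) →
                     let l = λ j → x j ∙ perp (v j) in
                     cycleProduct v l * h (a f0) (a f1) (a f2) ≈ - altSum v l a
  h-expansion-perp v x a = solve 21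
    (λ x₀ x₁ x₂ v₀₀ v₀₁ v₁₀ v₁₁ v₂₀ v₂₁
       a₀₀₀ a₀₀₁ a₀₁₀ a₀₁₁ a₁₀₀ a₁₀₁ a₁₁₀ a₁₁₁ a₂₀₀ a₂₀₁ a₂₁₀ a₂₁₁ →
      let vₚ = fam₃ (vec₂ v₀₀ v₀₁) (vec₂ v₁₀ v₁₁) (vec₂ v₂₀ v₂₁)
          aₚ = fam₃ (mat₂ a₀₀₀ a₀₀₁ a₀₁₀ a₀₁₁) (mat₂ a₁₀₀ a₁₀₁ a₁₁₀ a₁₁₁) (mat₂ a₂₀₀ a₂₀₁ a₂₁₀ a₂₁₁)
          lₚ = λ j k → fam₃ x₀ x₁ x₂ j :* perpₚ (vₚ j) k
      in cycleProductₚ vₚ lₚ :* hₚ (aₚ f0) (aₚ f1) (aₚ f2) := :- altSumₚ vₚ lₚ aₚ)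
    refl
    (x f0) (x f1) (x f2) (v f0 zero) (v f0 one) (v f1 zero) (v f1 one) (v f2 zero) (v f2 one)
    (a f0 zero zero) (a f0 zero one) (a f0 one zero) (a f0 one one)
    (a f1 zero zero) (a f1 zero one) (a f1 one zero) (a f1 one one)
    (a f2 zero zero) (a f2 zero one) (a f2 one zero) (a f2 one one)
    where
    open Symbolic
    one : Fin 2
    one = suc zero

  h-expansion : ∀ v l (x : Fin 3 → Carrier) → (∀ j k → l j k ≈ (x j ∙ perp (v j)) k) →
                ∀ a → cycleProduct v l * h (a f0) (a f1) (a f2) ≈ - altSum v l a
  h-expansion v l x l≈x∙perp a = begin
    cycleProduct v l * h (a f0) (a f1) (a f2)    ≈⟨ *-congʳ (cycleProduct-cong v {l′ = l′} l≈x∙perp) ⟩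
    cycleProduct v l′ * h (a f0) (a f1) (a f2)   ≈⟨ h-expansion-perp v x a ⟩
    - altSum v l′ a                              ≈⟨ -‿cong (altSum-cong v {l′ = l′} l≈x∙perp a) ⟨
    - altSum v l a                               ∎
    where
    l′ : Fin 3 → Covect
    l′ j = x j ∙ perp (v j)

proposition4p8 : {c ℓ : Level} (F : Field c ℓ) →
    let open Field F
        open FieldDefs F
    in (v : Fin 3 → Vect) (l : Fin 3 → Covect) →
       (∀ i → NonzeroVec (v i)) →
       (∀ i j → i ≢ j → ¬ Colinear (v i) (v j)) →
       (∀ i → NonzeroVec (l i)) →
       (∀ i → ev (l i) (v i) ≈ 0#) →
       Σ (¬ (ev (l f0) (v f1) * ev (l f1) (v f2) * ev (l f2) (v f0) ≈ 0#)) λ nz →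
         (a : Fin 3 → Mat) →
           h (a f0) (a f1) (a f2)
             ≈ - inv (ev (l f0) (v f1) * ev (l f1) (v f2) * ev (l f2) (v f0)) nz
                 * altSum v l a
proposition4p8 F v l v≉0 v∦v l≉0 lv≈0 = D≉0 , λ a →
  trans (x*y≈z⇒y≈x⁻¹*z D≉0 (h-expansion v l x l≈x∙perp a)) (x*-y≈-x*y _ _)
  where
  open Field F hiding (zero)
  open FieldDefs F
  open Plane F

  det≉0 : ∀ j → ¬ det (v j) (v (cyc j)) ≈ 0#
  det≉0 j = ¬colinear⇒det≉0 (v≉0 (cyc j)) (v∦v j (cyc j) (cyc-fixpoint-free j))

  x : Fin 3 → Carrier
  x j = inv (det (v j) (v (cyc j))) (det≉0 j) * ev (l j) (v (cyc j))

  l≈x∙perp : ∀ j k → l j k ≈ (x j ∙ perp (v j)) k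
  l≈x∙perp j = annihilator-∝-perp (l j) (v j) (v (cyc j)) (lv≈0 j) (det≉0 j)

  D≉0 : ¬ cycleProduct v l ≈ 0#
  D≉0 = *-nonzero (*-nonzero (factor≉0 f0) (factor≉0 f1)) (factor≉0 f2)
    where
    factor≉0 : ∀ j → ¬ ev (l j) (v (cyc j)) ≈ 0#
    factor≉0 j = annihilator-nonzero (l j) (v j) (v (cyc j)) (l≉0 j) (lv≈0 j) (det≉0 j)
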